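{- Let $m, n \ge 1$ be integers and $d$ a nonzero integer. Let $f(x)$, $P(x)$, $Q(x)$ be real polynomials of degrees $m$, $nm$ and $(n-1)m$ respectively, each with positive leading coefficient, satisfying \[ P^2 - (f^2(x) + d)Q^2 = (-d)^n. \] Define $P'(x) = -\frac{f(x)}{d} P(x) + \frac{f^2(x)+d}{d}Q(x)$ and $Q'(x) = \frac{1}{d} P(x) - \frac{f(x)}{d} Q(x)$. Then (1) $P'^2 - (f^2(x)+d)Q'^2 = (-d)^{n-1}$, and (2) $\deg P' < \deg P$ and $\deg Q' < \deg Q$. -}

module Defs where

open import Level using (Level; _⊔_) renaming (suc to lsuc)
open import Algebra.Bundles using (CommutativeRing)
open import Relation.Binary.Core using (Rel)
open import Relation.Binary.Structures using (IsStrictTotalOrder)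
open import Relation.Nullary using (¬_)
open import Data.Nat as ℕ using (ℕ; zero; suc)
open import Data.Integer as ℤ using (ℤ; +_; -[1+_])
open import Data.List using (List; []; _∷_; map)
open import Data.Product using (_×_)

-- The real numbers are an
-- instance; the statement is quantified over every such field.
record OrderedField (c ℓ₁ ℓ₂ : Level) : Set (lsuc (c ⊔ ℓ₁ ⊔ ℓ₂)) where
  field
    commutativeRing : CommutativeRing c ℓ₁
  open CommutativeRing commutativeRing public
  field
    _<_                  : Rel Carrier ℓ₂
    <-isStrictTotalOrder : IsStrictTotalOrder _≈_ _<_
    +-monoˡ-<            : ∀ {x y} z → x < y → (x + z) < (y + z)
    *-pos                : ∀ {x y} → 0# < x → 0# < y → 0# < (x * y)
    0<1                  : 0# < 1#
    _⁻¹                  : Carrier → Carrier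
    ⁻¹-inverse           : ∀ x → ¬ (x ≈ 0#) → (x * (x ⁻¹)) ≈ 1#

-- Polynomials over an ordered field, as coefficient lists (constant term first).
module PolyOver {c ℓ₁ ℓ₂} (F : OrderedField c ℓ₁ ℓ₂) where
  open OrderedField F

  Poly : Set c
  Poly = List Carrier

  coeff : Poly → ℕ → Carrier
  coeff []       _       = 0#
  coeff (a ∷ p)  zero    = a
  coeff (a ∷ p)  (suc i) = coeff p i

  _≋_ : Poly → Poly → Set ℓ₁
  p ≋ q = ∀ i → coeff p i ≈ coeff q i

  infixl 6 _+ₚ_ _-ₚ_
  infixl 7 _*ₚ_ _·ₚ_

  _+ₚ_ : Poly → Poly → Poly
  []      +ₚ q       = q
  (a ∷ p) +ₚ []      = a ∷ p
  (a ∷ p) +ₚ (b ∷ q) = (a + b) ∷ (p +ₚ q)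

  _·ₚ_ : Carrier → Poly → Poly
  k ·ₚ p = map (k *_) p

  negₚ : Poly → Poly
  negₚ p = map -_ p

  _-ₚ_ : Poly → Poly → Poly
  p -ₚ q = p +ₚ negₚ q

  _*ₚ_ : Poly → Poly → Poly
  []      *ₚ q = []
  (a ∷ p) *ₚ q = (a ·ₚ q) +ₚ (0# ∷ (p *ₚ q))

  const : Carrier → Poly
  const k = k ∷ []

  fromℕ : ℕ → Carrier
  fromℕ zero    = 0#
  fromℕ (suc n) = 1# + fromℕ n

  fromℤ : ℤ → Carrier
  fromℤ (+ n)      = fromℕ n
  fromℤ -[1+ n ]   = - fromℕ (suc n)

  DegPos : Poly → ℕ → Set (ℓ₁ ⊔ ℓ₂)
  DegPos p k = (0# < coeff p k) × (∀ i → k ℕ.< i → coeff p i ≈ 0#)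

  -- deg p < k  (the zero polynomial, of degree -∞, satisfies this for every k)
  DegLt : Poly → ℕ → Set ℓ₁
  DegLt p k = ∀ i → k ℕ.≤ i → coeff p i ≈ 0#

  fsqd : ℤ → Poly → Poly
  fsqd d f = (f *ₚ f) +ₚ const (fromℤ d)

  P′ : ℤ → Poly → Poly → Poly → Poly
  P′ d f P Q = negₚ ((fromℤ d ⁻¹) ·ₚ (f *ₚ P)) +ₚ ((fromℤ d ⁻¹) ·ₚ (fsqd d f *ₚ Q))

  Q′ : ℤ → Poly → Poly → Poly → Poly
  Q′ d f P Q = ((fromℤ d ⁻¹) ·ₚ P) -ₚ ((fromℤ d ⁻¹) ·ₚ (f *ₚ Q))

  pell : ℤ → Poly → Poly → Poly → Poly
  pell d f A B = (A *ₚ A) -ₚ (fsqd d f *ₚ (B *ₚ B))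

{-# OPTIONS --safe #-}
-- With c = 1/d, the substitution (P, Q) ↦ (P′, Q′) multiplies P² − (f² + d)Q² by
-- −c, a polynomial identity; since −c(−d)ⁿ = (−d)ⁿ⁻¹ this gives (1).  For (2), write
-- P′ = Q − cf(P − fQ) and Q′ = c(P − fQ): it suffices that deg(P − fQ) < (n − 1)m.
-- This follows from (P + fQ)(P − fQ) = (−d)ⁿ + dQ², whose degree is below (2n − 1)m,
-- while P + fQ has degree exactly nm because P and fQ both have positive leading
-- coefficients in degree nm, so no cancellation can occur.
module Submission where

open import Defs
open import Algebra.Bundles using (CommutativeRing)
import Algebra.Solver.Ring
open import Algebra.Solver.Ring.AlmostCommutativeRing
  using (_-Raw-AlmostCommutative⟶_; fromCommutativeRing)
open import Data.Empty using (⊥-elim)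
open import Data.Integer as ℤ using (ℤ; 0ℤ; +_; -[1+_]; _⊖_)
import Data.Integer.Properties as ℤ
open import Data.List using ([]; _∷_; length)
open import Data.Maybe using (Maybe; just; nothing)
open import Data.Nat as ℕ using (ℕ; zero; suc; z≤n; s≤s)
import Data.Nat.Properties as ℕ
open import Data.Product using (_×_; _,_; proj₁; proj₂)
open import Data.Sign as Sign using (Sign)
open import Data.Sum using (inj₁; inj₂)
open import Relation.Binary.PropositionalEquality as ≡ using (_≡_; _≢_)
open import Relation.Binary.Structures using (IsStrictTotalOrder)
open import Relation.Nullary using (¬_; yes; no)

module IntegerEmbedding {c ℓ} (R : CommutativeRing c ℓ) where
  open CommutativeRing R
  open import Algebra.Properties.Semiring.Mult semiring using (×-homo-+; ×1-homo-*)
    renaming (_×_ to _·_)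
  open import Algebra.Properties.Ring ring using (-1*x≈-x)
  open import Algebra.Properties.AbelianGroup +-abelianGroup using (⁻¹-∙-comm)
  open import Algebra.Properties.Group +-group using (ε⁻¹≈ε; ⁻¹-involutive)
  open import Relation.Binary.Reasoning.Setoid setoid

  ι : ℤ → Carrier
  ι (+ n)    = n · 1#
  ι -[1+ n ] = - (suc n · 1#)

  private
    +-cancelˡ-- : ∀ x a b → (x + a) - (x + b) ≈ a - b
    +-cancelˡ-- x a b = begin
      (x + a) - (x + b)      ≈⟨ +-cong (+-comm x a) (sym (⁻¹-∙-comm x b)) ⟩
      (a + x) + (- x - b)    ≈⟨ +-assoc a x _ ⟩
      a + (x + (- x - b))    ≈⟨ +-congˡ (sym (+-assoc x (- x) (- b))) ⟩
      a + ((x - x) - b)      ≈⟨ +-congˡ (+-congʳ (-‿inverseʳ x)) ⟩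
      a + (0# - b)           ≈⟨ +-congˡ (+-identityˡ (- b)) ⟩
      a - b                  ∎

  ι-⊖ : ∀ m n → ι (m ⊖ n) ≈ m · 1# - n · 1#
  ι-⊖ m       zero    rewrite ℤ.⊖-≥ (z≤n {m}) =
    sym (trans (+-congˡ ε⁻¹≈ε) (+-identityʳ _))
  ι-⊖ zero    (suc n) rewrite ℤ.⊖-≤ (z≤n {suc n}) = sym (+-identityˡ _)
  ι-⊖ (suc m) (suc n) rewrite ℤ.[1+m]⊖[1+n]≡m⊖n m n =
    trans (ι-⊖ m n) (sym (+-cancelˡ-- 1# _ _))

  ι-+ : ∀ i j → ι (i ℤ.+ j) ≈ ι i + ι j
  ι-+ -[1+ m ] -[1+ n ] = begin
    - (suc (suc (m ℕ.+ n)) · 1#)      ≡⟨ ≡.cong (λ k → - (suc k · 1#)) (≡.sym (ℕ.+-suc m n)) ⟩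
    - ((suc m ℕ.+ suc n) · 1#)        ≈⟨ -‿cong (×-homo-+ 1# (suc m) (suc n)) ⟩
    - (suc m · 1# + suc n · 1#)       ≈⟨ sym (⁻¹-∙-comm _ _) ⟩
    - (suc m · 1#) - (suc n · 1#)     ∎
  ι-+ -[1+ m ] (+ n)    = trans (ι-⊖ n (suc m)) (+-comm _ _)
  ι-+ (+ m)    -[1+ n ] = ι-⊖ m (suc n)
  ι-+ (+ m)    (+ n)    = ×-homo-+ 1# m n

  ι-neg : ∀ i → ι (ℤ.- i) ≈ - ι i
  ι-neg -[1+ n ]    = sym (⁻¹-involutive _)
  ι-neg (+ zero)    = sym ε⁻¹≈ε
  ι-neg (+ (suc n)) = refl

  ±1 : Sign → Carrier
  ±1 Sign.+ = 1#
  ±1 Sign.- = - 1#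

  ±1-* : ∀ s t → ±1 (s Sign.* t) ≈ ±1 s * ±1 t
  ±1-* Sign.+ t      = sym (*-identityˡ _)
  ±1-* Sign.- Sign.+ = sym (*-identityʳ _)
  ±1-* Sign.- Sign.- = sym (trans (-1*x≈-x _) (⁻¹-involutive _))

  ι-◃ : ∀ s n → ι (s ℤ.◃ n) ≈ ±1 s * (n · 1#)
  ι-◃ s      zero    = sym (zeroʳ _)
  ι-◃ Sign.+ (suc n) = sym (*-identityˡ _)
  ι-◃ Sign.- (suc n) = sym (-1*x≈-x _)

  ι-signAbs : ∀ i → ι i ≈ ±1 (ℤ.sign i) * (ℤ.∣ i ∣ · 1#)
  ι-signAbs i = begin
    ι i                                  ≡⟨ ≡.cong ι (≡.sym (ℤ.◃-inverse i)) ⟩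
    ι (ℤ.sign i ℤ.◃ ℤ.∣ i ∣)             ≈⟨ ι-◃ (ℤ.sign i) ℤ.∣ i ∣ ⟩
    ±1 (ℤ.sign i) * (ℤ.∣ i ∣ · 1#)       ∎

  private
    *-interchange : ∀ a b x y → (a * b) * (x * y) ≈ (a * x) * (b * y)
    *-interchange a b x y = begin
      (a * b) * (x * y) ≈⟨ *-assoc a b _ ⟩
      a * (b * (x * y)) ≈⟨ *-congˡ (sym (*-assoc b x y)) ⟩
      a * ((b * x) * y) ≈⟨ *-congˡ (*-congʳ (*-comm b x)) ⟩
      a * ((x * b) * y) ≈⟨ *-congˡ (*-assoc x b y) ⟩
      a * (x * (b * y)) ≈⟨ sym (*-assoc a x _) ⟩
      (a * x) * (b * y) ∎

  ι-* : ∀ i j → ι (i ℤ.* j) ≈ ι i * ι j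
  ι-* i j = begin
    ι (s ℤ.◃ ℤ.∣ i ∣ ℕ.* ℤ.∣ j ∣)                                 ≈⟨ ι-◃ s (ℤ.∣ i ∣ ℕ.* ℤ.∣ j ∣) ⟩
    ±1 s * ((ℤ.∣ i ∣ ℕ.* ℤ.∣ j ∣) · 1#)                           ≈⟨ *-cong (±1-* (ℤ.sign i) (ℤ.sign j)) (×1-homo-* ℤ.∣ i ∣ ℤ.∣ j ∣) ⟩
    (±1 (ℤ.sign i) * ±1 (ℤ.sign j)) * (ℤ.∣ i ∣ · 1# * ℤ.∣ j ∣ · 1#) ≈⟨ *-interchange _ _ _ _ ⟩
    (±1 (ℤ.sign i) * ℤ.∣ i ∣ · 1#) * (±1 (ℤ.sign j) * ℤ.∣ j ∣ · 1#) ≈⟨ sym (*-cong (ι-signAbs i) (ι-signAbs j)) ⟩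
    ι i * ι j ∎
    where s = ℤ.sign i Sign.* ℤ.sign j

  ι-morphism : ℤ.+-*-rawRing -Raw-AlmostCommutative⟶ fromCommutativeRing R
  ι-morphism = record
    { ⟦_⟧ = ι ; +-homo = ι-+ ; *-homo = ι-* ; -‿homo = ι-neg
    ; 0-homo = refl ; 1-homo = +-identityʳ 1# }

  ι-≟ : ∀ i j → Maybe (ι i ≈ ι j)
  ι-≟ i j with i ℤ.≟ j
  ... | yes ≡.refl = just refl
  ... | no _       = nothing

  -- The solver normalises over ℤ, whose equality is decidable, and reads the result in R via ι.
  module RingSolver = Algebra.Solver.Ring ℤ.+-*-rawRing (fromCommutativeRing R) ι-morphism ι-≟

module PolynomialRing {c ℓ₁ ℓ₂} (F : OrderedField c ℓ₁ ℓ₂) where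
  open OrderedField F
  open PolyOver F
  open import Algebra.Structures using (IsCommutativeRing)
  open import Algebra.Properties.Group +-group using (ε⁻¹≈ε)
  open import Relation.Binary.Reasoning.Setoid setoid
  open IntegerEmbedding commutativeRing using (module RingSolver)
  open RingSolver using (solve; _:=_; _:+_)

  -- _≋_ unfolds to a Π-type from which the two polynomials cannot be inferred;
  -- the record wrapper keeps them visible to unification.
  infix 4 _≈ₚ_
  record _≈ₚ_ (p q : Poly) : Set ℓ₁ where
    constructor from-≋
    field to-≋ : p ≋ q
  open _≈ₚ_ public

  ≈ₚ-refl : ∀ {p} → p ≈ₚ p
  ≈ₚ-refl = from-≋ λ _ → refl

  ≈ₚ-sym : ∀ {p q} → p ≈ₚ q → q ≈ₚ p
  ≈ₚ-sym p≈q = from-≋ λ i → sym (to-≋ p≈q i)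

  ≈ₚ-trans : ∀ {p q r} → p ≈ₚ q → q ≈ₚ r → p ≈ₚ r
  ≈ₚ-trans p≈q q≈r = from-≋ λ i → trans (to-≋ p≈q i) (to-≋ q≈r i)

  coeff-+ₚ : ∀ p q i → coeff (p +ₚ q) i ≈ coeff p i + coeff q i
  coeff-+ₚ []      q       i       = sym (+-identityˡ _)
  coeff-+ₚ (a ∷ p) []      i       = sym (+-identityʳ _)
  coeff-+ₚ (a ∷ p) (b ∷ q) zero    = refl
  coeff-+ₚ (a ∷ p) (b ∷ q) (suc i) = coeff-+ₚ p q i

  coeff-·ₚ : ∀ k p i → coeff (k ·ₚ p) i ≈ k * coeff p i
  coeff-·ₚ k []      i       = sym (zeroʳ k)
  coeff-·ₚ k (a ∷ p) zero    = refl
  coeff-·ₚ k (a ∷ p) (suc i) = coeff-·ₚ k p i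

  coeff-negₚ : ∀ p i → coeff (negₚ p) i ≈ - coeff p i
  coeff-negₚ []      i       = sym ε⁻¹≈ε
  coeff-negₚ (a ∷ p) zero    = refl
  coeff-negₚ (a ∷ p) (suc i) = coeff-negₚ p i

  ∷-cong : ∀ {a b p q} → a ≈ b → p ≈ₚ q → (a ∷ p) ≈ₚ (b ∷ q)
  ∷-cong a≈b p≈q = from-≋ λ { zero → a≈b ; (suc i) → to-≋ p≈q i }

  +ₚ-cong : ∀ {p p′ q q′} → p ≈ₚ p′ → q ≈ₚ q′ → p +ₚ q ≈ₚ p′ +ₚ q′
  +ₚ-cong {p} {p′} {q} {q′} p≈p′ q≈q′ = from-≋ λ i → begin
    coeff (p +ₚ q) i       ≈⟨ coeff-+ₚ p q i ⟩
    coeff p i + coeff q i   ≈⟨ +-cong (to-≋ p≈p′ i) (to-≋ q≈q′ i) ⟩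
    coeff p′ i + coeff q′ i ≈⟨ coeff-+ₚ p′ q′ i ⟨
    coeff (p′ +ₚ q′) i     ∎

  ·ₚ-cong : ∀ {k k′ p p′} → k ≈ k′ → p ≈ₚ p′ → k ·ₚ p ≈ₚ k′ ·ₚ p′
  ·ₚ-cong {k} {k′} {p} {p′} k≈k′ p≈p′ = from-≋ λ i →
    trans (coeff-·ₚ k p i) (trans (*-cong k≈k′ (to-≋ p≈p′ i)) (sym (coeff-·ₚ k′ p′ i)))

  negₚ-cong : ∀ {p p′} → p ≈ₚ p′ → negₚ p ≈ₚ negₚ p′
  negₚ-cong {p} {p′} p≈p′ = from-≋ λ i →
    trans (coeff-negₚ p i) (trans (-‿cong (to-≋ p≈p′ i)) (sym (coeff-negₚ p′ i)))

  +ₚ-assoc : ∀ p q r → (p +ₚ q) +ₚ r ≈ₚ p +ₚ (q +ₚ r)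
  +ₚ-assoc p q r = from-≋ λ i → begin
    coeff ((p +ₚ q) +ₚ r) i             ≈⟨ coeff-+ₚ (p +ₚ q) r i ⟩
    coeff (p +ₚ q) i + coeff r i        ≈⟨ +-congʳ (coeff-+ₚ p q i) ⟩
    (coeff p i + coeff q i) + coeff r i ≈⟨ +-assoc _ _ _ ⟩
    coeff p i + (coeff q i + coeff r i) ≈⟨ +-congˡ (coeff-+ₚ q r i) ⟨
    coeff p i + coeff (q +ₚ r) i        ≈⟨ coeff-+ₚ p (q +ₚ r) i ⟨
    coeff (p +ₚ (q +ₚ r)) i             ∎

  +ₚ-comm : ∀ p q → p +ₚ q ≈ₚ q +ₚ p
  +ₚ-comm p q = from-≋ λ i → trans (coeff-+ₚ p q i) (trans (+-comm _ _) (sym (coeff-+ₚ q p i)))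

  +ₚ-identityʳ : ∀ p → p +ₚ [] ≈ₚ p
  +ₚ-identityʳ p = from-≋ λ i → trans (coeff-+ₚ p [] i) (+-identityʳ _)

  negₚ-inverseˡ : ∀ p → negₚ p +ₚ p ≈ₚ []
  negₚ-inverseˡ p = from-≋ λ i →
    trans (coeff-+ₚ (negₚ p) p i) (trans (+-congʳ (coeff-negₚ p i)) (-‿inverseˡ _))

  negₚ-inverseʳ : ∀ p → p +ₚ negₚ p ≈ₚ []
  negₚ-inverseʳ p = from-≋ λ i →
    trans (coeff-+ₚ p (negₚ p) i) (trans (+-congˡ (coeff-negₚ p i)) (-‿inverseʳ _))

  ·ₚ-distribʳ : ∀ a b p → (a + b) ·ₚ p ≈ₚ a ·ₚ p +ₚ b ·ₚ p
  ·ₚ-distribʳ a b p = from-≋ λ i → begin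
    coeff ((a + b) ·ₚ p) i              ≈⟨ coeff-·ₚ (a + b) p i ⟩
    (a + b) * coeff p i                 ≈⟨ distribʳ _ a b ⟩
    a * coeff p i + b * coeff p i       ≈⟨ +-cong (coeff-·ₚ a p i) (coeff-·ₚ b p i) ⟨
    coeff (a ·ₚ p) i + coeff (b ·ₚ p) i ≈⟨ coeff-+ₚ (a ·ₚ p) (b ·ₚ p) i ⟨
    coeff (a ·ₚ p +ₚ b ·ₚ p) i          ∎

  ·ₚ-distribˡ : ∀ k p q → k ·ₚ (p +ₚ q) ≈ₚ k ·ₚ p +ₚ k ·ₚ q
  ·ₚ-distribˡ k p q = from-≋ λ i → begin
    coeff (k ·ₚ (p +ₚ q)) i             ≈⟨ coeff-·ₚ k (p +ₚ q) i ⟩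
    k * coeff (p +ₚ q) i                ≈⟨ *-congˡ (coeff-+ₚ p q i) ⟩
    k * (coeff p i + coeff q i)         ≈⟨ distribˡ k _ _ ⟩
    k * coeff p i + k * coeff q i       ≈⟨ +-cong (coeff-·ₚ k p i) (coeff-·ₚ k q i) ⟨
    coeff (k ·ₚ p) i + coeff (k ·ₚ q) i ≈⟨ coeff-+ₚ (k ·ₚ p) (k ·ₚ q) i ⟨
    coeff (k ·ₚ p +ₚ k ·ₚ q) i          ∎

  ·ₚ-assoc : ∀ k l p → k ·ₚ (l ·ₚ p) ≈ₚ (k * l) ·ₚ p
  ·ₚ-assoc k l p = from-≋ λ i → begin
    coeff (k ·ₚ (l ·ₚ p)) i ≈⟨ coeff-·ₚ k (l ·ₚ p) i ⟩
    k * coeff (l ·ₚ p) i    ≈⟨ *-congˡ (coeff-·ₚ l p i) ⟩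
    k * (l * coeff p i)     ≈⟨ *-assoc k l _ ⟨
    (k * l) * coeff p i     ≈⟨ coeff-·ₚ (k * l) p i ⟨
    coeff ((k * l) ·ₚ p) i  ∎

  0·ₚ : ∀ p → 0# ·ₚ p ≈ₚ []
  0·ₚ p = from-≋ λ i → trans (coeff-·ₚ 0# p i) (zeroˡ _)

  ·ₚ-∷0 : ∀ k p → k ·ₚ (0# ∷ p) ≈ₚ 0# ∷ k ·ₚ p
  ·ₚ-∷0 k p = ∷-cong (zeroʳ k) ≈ₚ-refl

  ∷0-+ₚ : ∀ p q → 0# ∷ (p +ₚ q) ≈ₚ (0# ∷ p) +ₚ (0# ∷ q)
  ∷0-+ₚ p q = ∷-cong (sym (+-identityʳ 0#)) ≈ₚ-refl

  [0]≈[] : 0# ∷ [] ≈ₚ []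
  [0]≈[] = from-≋ λ { zero → refl ; (suc i) → refl }

  *ₚ-zeroʳ : ∀ p → p *ₚ [] ≈ₚ []
  *ₚ-zeroʳ []      = ≈ₚ-refl
  *ₚ-zeroʳ (a ∷ p) = ≈ₚ-trans (∷-cong refl (*ₚ-zeroʳ p)) [0]≈[]

  ∷0-*ₚ : ∀ p q → (0# ∷ p) *ₚ q ≈ₚ 0# ∷ (p *ₚ q)
  ∷0-*ₚ p q = +ₚ-cong (0·ₚ q) ≈ₚ-refl

  const-*ₚ : ∀ a p → const a *ₚ p ≈ₚ a ·ₚ p
  const-*ₚ a p = ≈ₚ-trans (+ₚ-cong ≈ₚ-refl [0]≈[]) (+ₚ-identityʳ (a ·ₚ p))

  const-* : ∀ a b → const a *ₚ const b ≈ₚ const (a * b)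
  const-* a b = const-*ₚ a (const b)

  *ₚ-identityˡ : ∀ p → const 1# *ₚ p ≈ₚ p
  *ₚ-identityˡ p = ≈ₚ-trans (const-*ₚ 1# p) (from-≋ λ i → trans (coeff-·ₚ 1# p i) (*-identityˡ _))

  *ₚ-congˡ : ∀ p {q q′} → q ≈ₚ q′ → p *ₚ q ≈ₚ p *ₚ q′
  *ₚ-congˡ []      q≈q′ = ≈ₚ-refl
  *ₚ-congˡ (a ∷ p) q≈q′ = +ₚ-cong (·ₚ-cong refl q≈q′) (∷-cong refl (*ₚ-congˡ p q≈q′))

  +ₚ-interchange : ∀ p q r s → (p +ₚ q) +ₚ (r +ₚ s) ≈ₚ (p +ₚ r) +ₚ (q +ₚ s)
  +ₚ-interchange p q r s = from-≋ λ i → begin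
    coeff ((p +ₚ q) +ₚ (r +ₚ s)) i                      ≈⟨ coeff-+ₚ (p +ₚ q) (r +ₚ s) i ⟩
    coeff (p +ₚ q) i + coeff (r +ₚ s) i                 ≈⟨ +-cong (coeff-+ₚ p q i) (coeff-+ₚ r s i) ⟩
    (coeff p i + coeff q i) + (coeff r i + coeff s i)   ≈⟨ interchange _ _ _ _ ⟩
    (coeff p i + coeff r i) + (coeff q i + coeff s i)   ≈⟨ +-cong (coeff-+ₚ p r i) (coeff-+ₚ q s i) ⟨
    coeff (p +ₚ r) i + coeff (q +ₚ s) i                 ≈⟨ coeff-+ₚ (p +ₚ r) (q +ₚ s) i ⟨
    coeff ((p +ₚ r) +ₚ (q +ₚ s)) i                      ∎
    where
    interchange : ∀ a b x y → (a + b) + (x + y) ≈ (a + x) + (b + y)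
    interchange = solve 4 (λ a b x y → (a :+ b) :+ (x :+ y) := (a :+ x) :+ (b :+ y)) refl

  *ₚ-∷ʳ : ∀ p b q → p *ₚ (b ∷ q) ≈ₚ b ·ₚ p +ₚ (0# ∷ (p *ₚ q))
  *ₚ-∷ʳ []      b q = ≈ₚ-sym [0]≈[]
  *ₚ-∷ʳ (a ∷ p) b q = ∷-cong (+-congʳ (*-comm a b))
    (≈ₚ-trans (+ₚ-cong ≈ₚ-refl (*ₚ-∷ʳ p b q))
    (≈ₚ-trans (≈ₚ-sym (+ₚ-assoc (a ·ₚ q) (b ·ₚ p) _))
    (≈ₚ-trans (+ₚ-cong (+ₚ-comm (a ·ₚ q) (b ·ₚ p)) ≈ₚ-refl)
              (+ₚ-assoc (b ·ₚ p) (a ·ₚ q) _))))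

  *ₚ-comm : ∀ p q → p *ₚ q ≈ₚ q *ₚ p
  *ₚ-comm []      q = ≈ₚ-sym (*ₚ-zeroʳ q)
  *ₚ-comm (a ∷ p) q = ≈ₚ-trans (+ₚ-cong ≈ₚ-refl (∷-cong refl (*ₚ-comm p q))) (≈ₚ-sym (*ₚ-∷ʳ q a p))

  *ₚ-cong : ∀ {p p′ q q′} → p ≈ₚ p′ → q ≈ₚ q′ → p *ₚ q ≈ₚ p′ *ₚ q′
  *ₚ-cong {p} {p′} {q} {q′} p≈p′ q≈q′ =
    ≈ₚ-trans (*ₚ-congˡ p q≈q′) (≈ₚ-trans (*ₚ-comm p q′) (≈ₚ-trans (*ₚ-congˡ q′ p≈p′) (*ₚ-comm q′ p′)))

  *ₚ-distribʳ : ∀ r p q → (p +ₚ q) *ₚ r ≈ₚ p *ₚ r +ₚ q *ₚ r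
  *ₚ-distribʳ r []      q       = ≈ₚ-refl
  *ₚ-distribʳ r (a ∷ p) []      = ≈ₚ-sym (+ₚ-identityʳ _)
  *ₚ-distribʳ r (a ∷ p) (b ∷ q) =
    ≈ₚ-trans (+ₚ-cong (·ₚ-distribʳ a b r) (≈ₚ-trans (∷-cong refl (*ₚ-distribʳ r p q)) (∷0-+ₚ (p *ₚ r) (q *ₚ r))))
             (+ₚ-interchange (a ·ₚ r) (b ·ₚ r) (0# ∷ (p *ₚ r)) (0# ∷ (q *ₚ r)))

  *ₚ-distribˡ : ∀ r p q → r *ₚ (p +ₚ q) ≈ₚ r *ₚ p +ₚ r *ₚ q
  *ₚ-distribˡ r p q = ≈ₚ-trans (*ₚ-comm r (p +ₚ q))
    (≈ₚ-trans (*ₚ-distribʳ r p q) (+ₚ-cong (*ₚ-comm p r) (*ₚ-comm q r)))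

  ·ₚ-*ₚ : ∀ k p q → (k ·ₚ p) *ₚ q ≈ₚ k ·ₚ (p *ₚ q)
  ·ₚ-*ₚ k []      q = ≈ₚ-refl
  ·ₚ-*ₚ k (a ∷ p) q = ≈ₚ-trans (+ₚ-cong (≈ₚ-sym (·ₚ-assoc k a q)) (∷-cong refl (·ₚ-*ₚ k p q)))
    (≈ₚ-sym (≈ₚ-trans (·ₚ-distribˡ k (a ·ₚ q) (0# ∷ (p *ₚ q))) (+ₚ-cong ≈ₚ-refl (·ₚ-∷0 k (p *ₚ q)))))

  *ₚ-assoc : ∀ p q r → (p *ₚ q) *ₚ r ≈ₚ p *ₚ (q *ₚ r)
  *ₚ-assoc []      q r = ≈ₚ-refl
  *ₚ-assoc (a ∷ p) q r = ≈ₚ-trans (*ₚ-distribʳ r (a ·ₚ q) (0# ∷ (p *ₚ q)))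
    (+ₚ-cong (·ₚ-*ₚ a q r) (≈ₚ-trans (∷0-*ₚ (p *ₚ q) r) (∷-cong refl (*ₚ-assoc p q r))))

  ≈ₚ-isCommutativeRing : IsCommutativeRing _≈ₚ_ _+ₚ_ _*ₚ_ negₚ [] (const 1#)
  ≈ₚ-isCommutativeRing = record
    { isRing = record
      { +-isAbelianGroup = record
        { isGroup = record
          { isMonoid = record
            { isSemigroup = record
              { isMagma = record
                { isEquivalence = record { refl = ≈ₚ-refl ; sym = ≈ₚ-sym ; trans = ≈ₚ-trans }
                ; ∙-cong = +ₚ-cong }
              ; assoc = +ₚ-assoc }
            ; identity = (λ _ → ≈ₚ-refl) , +ₚ-identityʳ }
          ; inverse = negₚ-inverseˡ , negₚ-inverseʳ
          ; ⁻¹-cong = negₚ-cong }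
        ; comm = +ₚ-comm }
      ; *-cong = *ₚ-cong
      ; *-assoc = *ₚ-assoc
      ; *-identity = *ₚ-identityˡ , (λ p → ≈ₚ-trans (*ₚ-comm p _) (*ₚ-identityˡ p))
      ; distrib = *ₚ-distribˡ , *ₚ-distribʳ }
    ; *-comm = *ₚ-comm }

  polyRing : CommutativeRing c ℓ₁
  polyRing = record { isCommutativeRing = ≈ₚ-isCommutativeRing }

module OrderedFieldProperties {c ℓ₁ ℓ₂} (F : OrderedField c ℓ₁ ℓ₂) where
  open OrderedField F
  open PolyOver F using (fromℕ; fromℤ)
  open IntegerEmbedding commutativeRing using (ι; ι-*; ι-neg)
  open import Algebra.Properties.Group +-group using (⁻¹-involutive; ε⁻¹≈ε)
  open import Relation.Binary.Reasoning.Setoid setoid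
  open IsStrictTotalOrder <-isStrictTotalOrder using (irrefl; <-respʳ-≈) renaming (trans to <-trans)

  fromℤ≡ι : ∀ i → fromℤ i ≡ ι i
  fromℤ≡ι (+ n)    = fromℕ≡ n
    where
    fromℕ≡ : ∀ n → fromℕ n ≡ ι (+ n)
    fromℕ≡ zero    = ≡.refl
    fromℕ≡ (suc n) = ≡.cong (λ x → 1# + x) (fromℕ≡ n)
  fromℤ≡ι -[1+ n ] = ≡.cong -_ (fromℤ≡ι (+ suc n))

  fromℤ-* : ∀ i j → fromℤ (i ℤ.* j) ≈ fromℤ i * fromℤ j
  fromℤ-* i j rewrite fromℤ≡ι (i ℤ.* j) | fromℤ≡ι i | fromℤ≡ι j = ι-* i j

  fromℤ-neg : ∀ i → fromℤ (ℤ.- i) ≈ - fromℤ i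
  fromℤ-neg i rewrite fromℤ≡ι (ℤ.- i) | fromℤ≡ι i = ι-neg i

  >0⇒≉0 : ∀ {x} → 0# < x → ¬ x ≈ 0#
  >0⇒≉0 x>0 x≈0 = irrefl (sym x≈0) x>0

  +-pos : ∀ {x y} → 0# < x → 0# < y → 0# < (x + y)
  +-pos {x} {y} x>0 y>0 = <-trans (<-respʳ-≈ (sym (+-identityˡ y)) y>0) (+-monoˡ-< y x>0)

  fromℕ-suc-pos : ∀ n → 0# < fromℕ (suc n)
  fromℕ-suc-pos zero    = <-respʳ-≈ (sym (+-identityʳ 1#)) 0<1
  fromℕ-suc-pos (suc n) = +-pos 0<1 (fromℕ-suc-pos n)

  fromℤ-≉0 : ∀ {d} → d ≢ 0ℤ → ¬ fromℤ d ≈ 0#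
  fromℤ-≉0 {+ zero}    d≢0 = ⊥-elim (d≢0 ≡.refl)
  fromℤ-≉0 {+ (suc n)} d≢0 = >0⇒≉0 (fromℕ-suc-pos n)
  fromℤ-≉0 { -[1+ n ]} d≢0 -d≈0 =
    >0⇒≉0 (fromℕ-suc-pos n) (trans (sym (⁻¹-involutive _)) (trans (-‿cong -d≈0) ε⁻¹≈ε))

  ≉0∧*≈0⇒≈0 : ∀ {x y} → ¬ x ≈ 0# → x * y ≈ 0# → y ≈ 0#
  ≉0∧*≈0⇒≈0 {x} {y} x≉0 xy≈0 = begin
    y                   ≈⟨ *-identityˡ y ⟨
    1# * y              ≈⟨ *-congʳ (trans (*-comm (x ⁻¹) x) (⁻¹-inverse x x≉0)) ⟨
    (x ⁻¹ * x) * y      ≈⟨ *-assoc _ x y ⟩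
    x ⁻¹ * (x * y)      ≈⟨ *-congˡ xy≈0 ⟩
    x ⁻¹ * 0#           ≈⟨ zeroʳ _ ⟩
    0#                  ∎

module Degree {c ℓ₁ ℓ₂} (F : OrderedField c ℓ₁ ℓ₂) where
  open OrderedField F
  open PolyOver F
  open PolynomialRing F
  open OrderedFieldProperties F using (≉0∧*≈0⇒≈0; +-pos)
  open IsStrictTotalOrder <-isStrictTotalOrder using (<-respʳ-≈)
  open import Algebra.Properties.Group +-group using (ε⁻¹≈ε)
  open import Relation.Binary.Reasoning.Setoid setoid

  DegLt-[] : ∀ k → DegLt [] k
  DegLt-[] k _ _ = refl

  DegLt-mono : ∀ p {j k} → j ℕ.≤ k → DegLt p j → DegLt p k
  DegLt-mono p j≤k p<j i k≤i = p<j i (ℕ.≤-trans j≤k k≤i)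

  DegLt-resp : ∀ {p q} k → p ≈ₚ q → DegLt p k → DegLt q k
  DegLt-resp k p≈q p<k i k≤i = trans (sym (to-≋ p≈q i)) (p<k i k≤i)

  DegLt-+ₚ : ∀ p q k → DegLt p k → DegLt q k → DegLt (p +ₚ q) k
  DegLt-+ₚ p q k p<k q<k i k≤i =
    trans (coeff-+ₚ p q i) (trans (+-cong (p<k i k≤i) (q<k i k≤i)) (+-identityʳ 0#))

  DegLt-negₚ : ∀ p k → DegLt p k → DegLt (negₚ p) k
  DegLt-negₚ p k p<k i k≤i = trans (coeff-negₚ p i) (trans (-‿cong (p<k i k≤i)) ε⁻¹≈ε)

  DegLt-·ₚ : ∀ a p k → DegLt p k → DegLt (a ·ₚ p) k
  DegLt-·ₚ a p k p<k i k≤i = trans (coeff-·ₚ a p i) (trans (*-congˡ (p<k i k≤i)) (zeroʳ a))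

  DegLt-∷0 : ∀ p k → DegLt p k → DegLt (0# ∷ p) (suc k)
  DegLt-∷0 p k p<k (suc i) (s≤s k≤i) = p<k i k≤i

  DegLt-tail : ∀ a p k → DegLt (a ∷ p) (suc k) → DegLt p k
  DegLt-tail a p k ap<k i k≤i = ap<k (suc i) (s≤s k≤i)

  DegLt-length : ∀ p → DegLt p (length p)
  DegLt-length []      i       _         = refl
  DegLt-length (a ∷ p) (suc i) (s≤s l≤i) = DegLt-length p i l≤i

  DegLt-lower : ∀ p k → DegLt p (suc k) → coeff p k ≈ 0# → DegLt p k
  DegLt-lower p k p<1+k pₖ≈0 i k≤i with ℕ.m≤n⇒m<n∨m≡n k≤i
  ... | inj₁ k<i   = p<1+k i k<i
  ... | inj₂ ≡.refl = pₖ≈0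

  DegLt-0⇒≈[] : ∀ p → DegLt p 0 → p ≈ₚ []
  DegLt-0⇒≈[] p p<0 = from-≋ λ i → p<0 i z≤n

  private
    ∷0-*ₚ-≈[] : ∀ p q → DegLt p 0 → 0# ∷ (p *ₚ q) ≈ₚ []
    ∷0-*ₚ-≈[] p q p<0 = ≈ₚ-trans (∷-cong refl (*ₚ-cong (DegLt-0⇒≈[] p p<0) ≈ₚ-refl)) [0]≈[]

  DegLt-*ₚ : ∀ p q a b → DegLt p (suc a) → DegLt q b → DegLt (p *ₚ q) (a ℕ.+ b)
  DegLt-*ₚ []      q a b _  _   = DegLt-[] (a ℕ.+ b)
  DegLt-*ₚ (x ∷ p) q a b xp<1+a q<b = DegLt-+ₚ (x ·ₚ q) (0# ∷ (p *ₚ q)) (a ℕ.+ b)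
    (DegLt-mono (x ·ₚ q) (ℕ.m≤n+m b a) (DegLt-·ₚ x q b q<b))
    (shifted a (DegLt-tail x p a xp<1+a))
    where
    shifted : ∀ a → DegLt p a → DegLt (0# ∷ (p *ₚ q)) (a ℕ.+ b)
    shifted zero    p<0 = DegLt-resp b (≈ₚ-sym (∷0-*ₚ-≈[] p q p<0)) (DegLt-[] b)
    shifted (suc a) p<a = DegLt-∷0 (p *ₚ q) (a ℕ.+ b) (DegLt-*ₚ p q a b p<a q<b)

  coeff-*ₚ-leading : ∀ p q a b → DegLt p (suc a) → DegLt q (suc b) →
                     coeff (p *ₚ q) (a ℕ.+ b) ≈ coeff p a * coeff q b
  coeff-*ₚ-leading []      q a       b _   _   = sym (zeroˡ _)
  coeff-*ₚ-leading (x ∷ p) q zero    b xp<1 _   = begin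
    coeff (x ·ₚ q +ₚ (0# ∷ (p *ₚ q))) b       ≈⟨ coeff-+ₚ (x ·ₚ q) _ b ⟩
    coeff (x ·ₚ q) b + coeff (0# ∷ (p *ₚ q)) b ≈⟨ +-cong (coeff-·ₚ x q b) (to-≋ (∷0-*ₚ-≈[] p q (DegLt-tail x p 0 xp<1)) b) ⟩
    x * coeff q b + 0#                         ≈⟨ +-identityʳ _ ⟩
    x * coeff q b                              ∎
  coeff-*ₚ-leading (x ∷ p) q (suc a) b xp<2+a q<1+b = begin
    coeff (x ·ₚ q +ₚ (0# ∷ (p *ₚ q))) (suc (a ℕ.+ b))       ≈⟨ coeff-+ₚ (x ·ₚ q) _ (suc (a ℕ.+ b)) ⟩
    coeff (x ·ₚ q) (suc (a ℕ.+ b)) + coeff (p *ₚ q) (a ℕ.+ b) ≈⟨ +-cong (DegLt-·ₚ x q (suc b) q<1+b _ (s≤s (ℕ.m≤n+m b a)))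
                                                                         (coeff-*ₚ-leading p q a b (DegLt-tail x p (suc a) xp<2+a) q<1+b) ⟩
    0# + coeff p a * coeff q b                                 ≈⟨ +-identityˡ _ ⟩
    coeff p a * coeff q b                                      ∎

  DegLt-*ₚ-cancelˡ : ∀ p q a b → DegLt p (suc a) → ¬ coeff p a ≈ 0# →
                     DegLt (p *ₚ q) (a ℕ.+ b) → DegLt q b
  DegLt-*ₚ-cancelˡ p q a b p<1+a pₐ≉0 pq<a+b =
    descend (length q) (DegLt-mono q (ℕ.m≤n+m (length q) b) (DegLt-length q))
    where
    descend : ∀ l → DegLt q (b ℕ.+ l) → DegLt q b
    descend zero    q<b+0 = ≡.subst (DegLt q) (ℕ.+-identityʳ b) q<b+0
    descend (suc l) q<b+1+l = descend l (DegLt-lower q (b ℕ.+ l) q<1+b+l q₍b+l₎≈0)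
      where
      q<1+b+l : DegLt q (suc (b ℕ.+ l))
      q<1+b+l = ≡.subst (DegLt q) (ℕ.+-suc b l) q<b+1+l
      q₍b+l₎≈0 : coeff q (b ℕ.+ l) ≈ 0#
      q₍b+l₎≈0 = ≉0∧*≈0⇒≈0 pₐ≉0 (trans (sym (coeff-*ₚ-leading p q a (b ℕ.+ l) p<1+a q<1+b+l))
                                       (pq<a+b _ (ℕ.+-monoʳ-≤ a (ℕ.m≤m+n b l))))

  DegLt-const : ∀ a → DegLt (const a) 1
  DegLt-const a (suc i) _ = refl

  DegLt-const-*ₚ : ∀ a p k → DegLt p k → DegLt (const a *ₚ p) k
  DegLt-const-*ₚ a p k p<k = DegLt-resp k (≈ₚ-sym (const-*ₚ a p)) (DegLt-·ₚ a p k p<k)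

  DegPos-+ₚ : ∀ p q k → DegPos p k → DegPos q k → DegPos (p +ₚ q) k
  DegPos-+ₚ p q k (pₖ>0 , p<1+k) (qₖ>0 , q<1+k) =
    <-respʳ-≈ (sym (coeff-+ₚ p q k)) (+-pos pₖ>0 qₖ>0) , DegLt-+ₚ p q (suc k) p<1+k q<1+k

  DegPos-*ₚ : ∀ p q a b → DegPos p a → DegPos q b → DegPos (p *ₚ q) (a ℕ.+ b)
  DegPos-*ₚ p q a b (pₐ>0 , p<1+a) (q_b>0 , q<1+b) =
    <-respʳ-≈ (sym (coeff-*ₚ-leading p q a b p<1+a q<1+b)) (*-pos pₐ>0 q_b>0) ,
    ≡.subst (DegLt (p *ₚ q)) (ℕ.+-suc a b) (DegLt-*ₚ p q a (suc b) p<1+a q<1+b)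

module PellDescent {c ℓ₁ ℓ₂} (F : OrderedField c ℓ₁ ℓ₂) where
  open OrderedField F
  open PolyOver F
  open PolynomialRing F
  open Degree F
  open OrderedFieldProperties F
  open import Relation.Binary.Reasoning.Setoid setoid

  fromℤ-^-descent : ∀ d k → d ≢ 0ℤ →
    - (fromℤ d ⁻¹ * fromℤ d ⁻¹ * fromℤ d) * fromℤ ((ℤ.- d) ℤ.^ suc k) ≈ fromℤ ((ℤ.- d) ℤ.^ k)
  fromℤ-^-descent d k d≢0 = begin
    - (δ⁻¹ * δ⁻¹ * δ) * fromℤ ((ℤ.- d) ℤ.* y)     ≈⟨ *-congˡ (fromℤ-* (ℤ.- d) y) ⟩
    - (δ⁻¹ * δ⁻¹ * δ) * (fromℤ (ℤ.- d) * fromℤ y) ≈⟨ *-congˡ (*-congʳ (fromℤ-neg d)) ⟩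
    - (δ⁻¹ * δ⁻¹ * δ) * (- δ * fromℤ y)           ≈⟨ regroup δ⁻¹ δ (fromℤ y) ⟩
    (δ * δ⁻¹) * ((δ * δ⁻¹) * fromℤ y)             ≈⟨ *-cong δδ⁻¹≈1 (*-congʳ δδ⁻¹≈1) ⟩
    1# * (1# * fromℤ y)                           ≈⟨ trans (*-identityˡ _) (*-identityˡ _) ⟩
    fromℤ y                                       ∎
    where
    open IntegerEmbedding.RingSolver commutativeRing using (solve; _:=_; _:*_; :-_)
    δ δ⁻¹ : Carrier
    δ   = fromℤ d
    δ⁻¹ = δ ⁻¹
    y : ℤ
    y = (ℤ.- d) ℤ.^ k
    δδ⁻¹≈1 : δ * δ⁻¹ ≈ 1#
    δδ⁻¹≈1 = ⁻¹-inverse δ (fromℤ-≉0 d≢0)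
    regroup : ∀ a b x → - (a * a * b) * (- b * x) ≈ (b * a) * ((b * a) * x)
    regroup = solve 3 (λ a b x → :- (a :* a :* b) :* (:- b :* x) := (b :* a) :* ((b :* a) :* x)) refl

  module _ (d : ℤ) (f P Q : Poly) where
    open IntegerEmbedding.RingSolver polyRing using (solve; _:=_; _:+_; _:-_; _:*_; :-_)

    private
      C D : Poly
      C = const (fromℤ d ⁻¹)
      D = const (fromℤ d)

    P′≈ : P′ d f P Q ≈ₚ C *ₚ (D *ₚ Q) -ₚ C *ₚ (f *ₚ (P -ₚ f *ₚ Q))
    P′≈ = ≈ₚ-trans
      (+ₚ-cong (negₚ-cong (≈ₚ-sym (const-*ₚ _ (f *ₚ P)))) (≈ₚ-sym (const-*ₚ _ (fsqd d f *ₚ Q))))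
      (solve 5 (λ C D f P Q →
          :- (C :* (f :* P)) :+ C :* ((f :* f :+ D) :* Q)
        := C :* (D :* Q) :- C :* (f :* (P :- f :* Q))) ≈ₚ-refl C D f P Q)

    Q′≈ : Q′ d f P Q ≈ₚ C *ₚ (P -ₚ f *ₚ Q)
    Q′≈ = ≈ₚ-trans
      (+ₚ-cong (≈ₚ-sym (const-*ₚ _ P)) (negₚ-cong (≈ₚ-sym (const-*ₚ _ (f *ₚ Q)))))
      (solve 4 (λ C f P Q → C :* P :- C :* (f :* Q) := C :* (P :- f :* Q)) ≈ₚ-refl C f P Q)

    pell-P′-Q′ : pell d f (P′ d f P Q) (Q′ d f P Q) ≈ₚ negₚ (C *ₚ C *ₚ D) *ₚ pell d f P Q
    pell-P′-Q′ = ≈ₚ-trans (pell-cong P′≈ Q′≈)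
      (solve 5 (λ C D f P Q →
          (C :* (D :* Q) :- C :* (f :* (P :- f :* Q))) :* (C :* (D :* Q) :- C :* (f :* (P :- f :* Q)))
            :- (f :* f :+ D) :* ((C :* (P :- f :* Q)) :* (C :* (P :- f :* Q)))
        := :- (C :* C :* D) :* (P :* P :- (f :* f :+ D) :* (Q :* Q))) ≈ₚ-refl C D f P Q)
      where
      pell-cong : ∀ {A A′ B B′} → A ≈ₚ A′ → B ≈ₚ B′ → pell d f A B ≈ₚ pell d f A′ B′
      pell-cong A≈A′ B≈B′ =
        +ₚ-cong (*ₚ-cong A≈A′ A≈A′) (negₚ-cong (*ₚ-cong (≈ₚ-refl {fsqd d f}) (*ₚ-cong B≈B′ B≈B′)))

    conjugates-*ₚ : (P +ₚ f *ₚ Q) *ₚ (P -ₚ f *ₚ Q) ≈ₚ pell d f P Q +ₚ D *ₚ (Q *ₚ Q)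
    conjugates-*ₚ = solve 4 (λ D f P Q →
        (P :+ f :* Q) :* (P :- f :* Q) := (P :* P :- (f :* f :+ D) :* (Q :* Q)) :+ D :* (Q :* Q))
      ≈ₚ-refl D f P Q

    pell-descent : d ≢ 0ℤ → ∀ k → pell d f P Q ≈ₚ const (fromℤ ((ℤ.- d) ℤ.^ suc k)) →
                   pell d f (P′ d f P Q) (Q′ d f P Q) ≈ₚ const (fromℤ ((ℤ.- d) ℤ.^ k))
    pell-descent d≢0 k pell≈ = ≈ₚ-trans pell-P′-Q′
      (≈ₚ-trans (*ₚ-cong (negₚ-cong C²D≈) pell≈)
      (≈ₚ-trans (const-* (- (δ⁻¹ * δ⁻¹ * δ)) _) (∷-cong (fromℤ-^-descent d k d≢0) ≈ₚ-refl)))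
      where
      δ δ⁻¹ : Carrier
      δ   = fromℤ d
      δ⁻¹ = δ ⁻¹
      C²D≈ : C *ₚ C *ₚ D ≈ₚ const (δ⁻¹ * δ⁻¹ * δ)
      C²D≈ = ≈ₚ-trans (*ₚ-cong (const-* δ⁻¹ δ⁻¹) (≈ₚ-refl {D})) (const-* (δ⁻¹ * δ⁻¹) δ)

    DegLt-conjugate : ∀ m K X → 1 ℕ.≤ m → DegPos f m → DegPos P (m ℕ.+ K) → DegPos Q K →
                      pell d f P Q ≈ₚ const X → DegLt (P -ₚ f *ₚ Q) K
    DegLt-conjugate m K X 1≤m f⁺ P⁺ Q⁺ pell≈ =
      DegLt-*ₚ-cancelˡ (P +ₚ f *ₚ Q) (P -ₚ f *ₚ Q) N K (proj₂ S⁺) (>0⇒≉0 (proj₁ S⁺)) SB<N+K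
      where
      N : ℕ
      N = m ℕ.+ K
      S⁺ : DegPos (P +ₚ f *ₚ Q) N
      S⁺ = DegPos-+ₚ P (f *ₚ Q) N P⁺ (DegPos-*ₚ f Q m K f⁺ Q⁺)
      1+K≤N : suc K ℕ.≤ N
      1+K≤N = ℕ.+-monoˡ-≤ K 1≤m
      Q²<K+1+K : DegLt (D *ₚ (Q *ₚ Q)) (K ℕ.+ suc K)
      Q²<K+1+K = DegLt-const-*ₚ _ (Q *ₚ Q) _ (DegLt-*ₚ Q Q K (suc K) (proj₂ Q⁺) (proj₂ Q⁺))
      SB<N+K : DegLt ((P +ₚ f *ₚ Q) *ₚ (P -ₚ f *ₚ Q)) (N ℕ.+ K)
      SB<N+K = DegLt-resp (N ℕ.+ K) (≈ₚ-sym (≈ₚ-trans conjugates-*ₚ (+ₚ-cong pell≈ ≈ₚ-refl)))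
        (DegLt-+ₚ (const X) (D *ₚ (Q *ₚ Q)) (N ℕ.+ K)
          (DegLt-mono (const X) 1≤N+K (DegLt-const X))
          (DegLt-mono (D *ₚ (Q *ₚ Q)) K+1+K≤N+K Q²<K+1+K))
        where
        1≤N+K : 1 ℕ.≤ N ℕ.+ K
        1≤N+K = ℕ.≤-trans (s≤s z≤n) (ℕ.≤-trans 1+K≤N (ℕ.m≤m+n N K))
        K+1+K≤N+K : K ℕ.+ suc K ℕ.≤ N ℕ.+ K
        K+1+K≤N+K = ℕ.≤-trans (ℕ.≤-reflexive (ℕ.+-comm K (suc K))) (ℕ.+-monoˡ-≤ K 1+K≤N)

    DegLt-Q′ : ∀ K → DegLt (P -ₚ f *ₚ Q) K → DegLt (Q′ d f P Q) K
    DegLt-Q′ K B<K = DegLt-resp K (≈ₚ-sym Q′≈) (DegLt-const-*ₚ _ (P -ₚ f *ₚ Q) K B<K)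

    DegLt-P′ : ∀ m K → DegLt f (suc m) → DegLt Q (m ℕ.+ K) → DegLt (P -ₚ f *ₚ Q) K →
               DegLt (P′ d f P Q) (m ℕ.+ K)
    DegLt-P′ m K f<1+m Q<N B<K = DegLt-resp N (≈ₚ-sym P′≈)
      (DegLt-+ₚ (C *ₚ (D *ₚ Q)) _ N
        (DegLt-const-*ₚ _ (D *ₚ Q) N (DegLt-const-*ₚ _ Q N Q<N))
        (DegLt-negₚ (C *ₚ (f *ₚ (P -ₚ f *ₚ Q))) N
          (DegLt-const-*ₚ _ (f *ₚ (P -ₚ f *ₚ Q)) N (DegLt-*ₚ f (P -ₚ f *ₚ Q) m K f<1+m B<K))))
      where
      N : ℕ
      N = m ℕ.+ K

-- Opened only here: unqualified -_ and _*_ would clash with the ring operations above.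
open import Data.Nat using (_≤_; _*_; _∸_)
open import Data.Integer using (-_; _^_)

lemma1 : ∀ {c ℓ₁ ℓ₂} (F : OrderedField c ℓ₁ ℓ₂) → let open PolyOver F in
    (m n : ℕ) → 1 ≤ m → 1 ≤ n → (d : ℤ) → d ≢ 0ℤ →
    (f P Q : Poly) →
    DegPos f m → DegPos P (n * m) → DegPos Q ((n ∸ 1) * m) →
    pell d f P Q ≋ const (fromℤ ((- d) ^ n)) →
    (pell d f (P′ d f P Q) (Q′ d f P Q) ≋ const (fromℤ ((- d) ^ (n ∸ 1))))
    × DegLt (P′ d f P Q) (n * m)
    × DegLt (Q′ d f P Q) ((n ∸ 1) * m)
lemma1 F m (suc k) 1≤m _ d d≢0 f P Q f⁺ P⁺ Q⁺ pell≋ =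
    to-≋ (pell-descent d f P Q d≢0 k pell≈)
  , DegLt-P′ d f P Q m K (proj₂ f⁺) (DegLt-mono Q (ℕ.+-monoˡ-≤ K 1≤m) (proj₂ Q⁺)) P-fQ<K
  , DegLt-Q′ d f P Q K P-fQ<K
  where
  open PolyOver F
  open PolynomialRing F
  open Degree F
  open PellDescent F
  K : ℕ
  K = k * m
  pell≈ : pell d f P Q ≈ₚ const (fromℤ ((- d) ^ suc k))
  pell≈ = from-≋ pell≋
  P-fQ<K : DegLt (P -ₚ f *ₚ Q) K
  P-fQ<K = DegLt-conjugate d f P Q m K _ 1≤m f⁺ P⁺ Q⁺ pell≈
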